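{- Let $\mathcal A=(Q,\Sigma,\delta,s,F)$ be a DFA satisfying the standing assumptions below, and let $u\in Q$. Then: (1) every $\alpha\in I_u$ is a finite string; (2) for every $v\in Q$ with $v\neq u$, $I_u\cap I_v=\emptyset$; (3) for every finite suffix $\alpha\in\Sigma^*$ of $\inf I_u$ (respectively of $\sup I_u$), there exists $\beta\in\Sigma^*$ such that $\beta\alpha\in I_u$; (4) $\inf I_u\in I_u$ if and only if $\inf I_u$ is a finite string; similarly, $\sup I_u\in I_u$ if and only if $\sup I_u$ is a finite string; (5) $I_u$ is a singleton if and only if $\inf I_u=\sup I_u$; in that case $I_u=\{\inf I_u\}$ and $\inf I_u=\sup I_u\in I_u$ is a finite string; (6) for every $v\in Q$ with $v\neq u$, if $\inf I_u=\inf I_v$ or $\inf I_u=\sup I_v$, then $\inf I_u$ has infinite length; similarly, if $\sup I_u=\inf I_v$ or $\sup I_u=\sup I_v$, then $\sup I_u$ has infinite length.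
   Context: A DFA is $\mathcal A=(Q,\Sigma,\delta,s,F)$ with finite state set $Q$, finite totally ordered alphabet $\Sigma$, (partial) transition function $\delta:Q\times\Sigma\to Q$, initial state $s$, final states $F$; $\delta$ is extended to words by $\delta(q,\epsilon)=q$, $\delta(q,a\alpha)=\delta(\delta(q,a),\alpha)$. Standing assumptions: $s$ has no incoming transitions; every state is reachable from $s$; and the DFA is input-consistent: all transitions entering a given state carry the same label. For $q\in Q$, $I_q=\{\alpha\in\Sigma^*:\delta(s,\alpha)=q\}$. Strings may be finite or left-infinite $\omega$-strings (built by prepending infinitely many characters, so appending a character at the right end is defined). The co-lex order on $\Sigma^*\cup\Sigma^\omega$: $\epsilon<\alpha$ for every nonempty $\alpha$, and for $\alpha=\alpha'a$, $\beta=\beta'b$ ($a,b\in\Sigma$), $\alpha<\beta$ iff $a<b$, or $a=b$ and $\alpha'<\beta'$. $\inf I_u$ (the infimum string) is the greatest lower bound of $I_u$ in $(\Sigma^*\cup\Sigma^\omega,\le)$ and $\sup I_u$ (the supremum string) is its least upper bound. -}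

module Defs where

open import Data.Nat using (ℕ; zero; suc)
open import Data.Fin using (Fin) renaming (_<_ to _<ꟳ_)
open import Data.List using (List; []; _∷_; reverse; _++_)
open import Data.Maybe using (Maybe; just; nothing)
open import Data.Bool using (Bool)
open import Data.Product using (Σ; _×_; _,_; ∃)
open import Data.Sum using (_⊎_)
open import Data.Unit using (⊤)
open import Data.Empty using (⊥)
open import Relation.Binary.PropositionalEquality using (_≡_; _≢_)
open import Relation.Nullary using (¬_)

-- Q = Fin n, alphabet Σ = Fin σ with its natural (total) order.
record DFA (n σ : ℕ) : Set where
  field
    δ     : Fin n → Fin σ → Maybe (Fin n)
    s     : Fin n
    final : Fin n → Bool

open DFA public

δ* : ∀ {n σ} → DFA n σ → Fin n → List (Fin σ) → Maybe (Fin n)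
δ* A q [] = just q
δ* A q (a ∷ α) with δ A q a
... | nothing = nothing
... | just p  = δ* A p α

record Standing {n σ} (A : DFA n σ) : Set where
  field
    s-no-incoming : ∀ q a → δ A q a ≢ just (s A)
    reachable     : ∀ q → ∃ λ α → δ* A (s A) α ≡ just q
    input-consistent : ∀ q p a b r → δ A q a ≡ just r → δ A p b ≡ just r → a ≡ b

-- Finite strings and left-infinite ω-strings, stored *reversed*:
-- fin r : the finite string whose characters read from the right end are r
--         (i.e. the string reverse r);
-- inf f : the left-infinite string ... f 2 f 1 f 0  (f 0 = rightmost char).
data Str (σ : ℕ) : Set where
  fin : List (Fin σ) → Str σ
  inf : (ℕ → Fin σ) → Str σ

⟦_⟧ : ∀ {σ} → List (Fin σ) → Str σ
⟦ α ⟧ = fin (reverse α)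

unsnoc : ∀ {σ} → Str σ → Maybe (Fin σ × Str σ)
unsnoc (fin [])      = nothing
unsnoc (fin (a ∷ r)) = just (a , fin r)
unsnoc (inf f)       = just (f 0 , inf (λ k → f (suc k)))

_≈_ : ∀ {σ} → Str σ → Str σ → Set
fin r ≈ fin r' = r ≡ r'
fin _ ≈ inf _  = ⊥
inf _ ≈ fin _  = ⊥
inf f ≈ inf g  = ∀ k → f k ≡ g k

IsFinite : ∀ {σ} → Str σ → Set
IsFinite (fin _) = ⊤
IsFinite (inf _) = ⊥

IsInfinite : ∀ {σ} → Str σ → Set
IsInfinite (fin _) = ⊥
IsInfinite (inf _) = ⊤

data _<ˢ_ {σ : ℕ} : Str σ → Str σ → Set where
  ε<  : ∀ {y b y'} → unsnoc y ≡ just (b , y') → fin [] <ˢ y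
  hd< : ∀ {x y a b x' y'} → unsnoc x ≡ just (a , x') → unsnoc y ≡ just (b , y') →
        a <ꟳ b → x <ˢ y
  tl< : ∀ {x y a x' y'} → unsnoc x ≡ just (a , x') → unsnoc y ≡ just (a , y') →
        x' <ˢ y' → x <ˢ y

_≤ˢ_ : ∀ {σ} → Str σ → Str σ → Set
x ≤ˢ y = x <ˢ y ⊎ x ≈ y

-- α ∈ Σ* is a suffix of x  (given the reversed word r = reverse α)
SuffixRev : ∀ {σ} → List (Fin σ) → Str σ → Set
SuffixRev []      x = ⊤
SuffixRev (a ∷ r) x = Σ _ λ x' → unsnoc x ≡ just (a , x') × SuffixRev r x'

IsSuffix : ∀ {σ} → List (Fin σ) → Str σ → Set
IsSuffix α x = SuffixRev (reverse α) x

I : ∀ {n σ} → DFA n σ → Fin n → Str σ → Set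
I A q x = Σ (List _) λ α → x ≈ ⟦ α ⟧ × δ* A (s A) α ≡ just q

IsInf : ∀ {σ} → Str σ → (Str σ → Set) → Set
IsInf x P = (∀ y → P y → x ≤ˢ y) × (∀ z → (∀ y → P y → z ≤ˢ y) → z ≤ˢ x)

IsSup : ∀ {σ} → Str σ → (Str σ → Set) → Set
IsSup x P = (∀ y → P y → y ≤ˢ x) × (∀ z → (∀ y → P y → y ≤ˢ z) → x ≤ˢ z)

IsSingleton : ∀ {σ} → (Str σ → Set) → Set
IsSingleton P = Σ _ λ x → P x × (∀ y → P y → y ≈ x)

-- Members of I_u are finite words, and a word lies in at most one I_u since
-- the automaton is deterministic.  The strings with a given finite suffix form
-- a co-lex interval whose least strict upper bound, if any, is finite, and which
-- has a strict lower bound above every finite string below it; if no member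
-- of I_u had a given suffix of inf I_u (resp. sup I_u), that neighbour would be
-- a better lower (resp. upper) bound of I_u.  A finite supremum p outside I_u
-- contradicts this for the suffix p itself, and a finite infimum p outside I_u
-- would be beaten by p with the least letter prepended.  Hence a finite
-- extremum shared by I_u and I_v would lie in both.  Membership of finite
-- strings is decidable and there are finitely many states, so the double
-- negations these arguments produce can be removed.
module Submission where

open import Defs
open import Data.Nat.Base as ℕ using (ℕ; zero; suc)
import Data.Nat.Properties as ℕ
open import Data.Fin as F using (Fin; zero; suc; toℕ; fromℕ; inject₁)
import Data.Fin.Properties as F
open import Data.List using (List; []; _∷_; _++_; reverse; [_])
import Data.List.Properties as List
open import Data.Maybe as Maybe using (Maybe; just; nothing; maybe′; _>>=_)
import Data.Maybe.Properties as Maybe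
open import Data.Product using (Σ-syntax; _×_; _,_; ∃; ∃-syntax; proj₁; proj₂)
import Data.Product.Properties as Product
open import Data.Sum using (_⊎_; inj₁; inj₂; [_,_]′)
open import Data.Empty using (⊥; ⊥-elim)
open import Data.Unit using (tt)
open import Function.Bundles using (_⇔_; mk⇔)
open import Relation.Binary.Definitions using (_Respects_)
open import Relation.Binary.PropositionalEquality
  using (_≡_; _≢_; refl; sym; trans; cong; subst; module ≡-Reasoning)
open import Relation.Nullary using (¬_; yes; no)
open import Relation.Nullary.Decidable using (Dec; map′; decidable-stable)
open import Relation.Unary using (Satisfiable; _⊆_)

private variable
  n σ : ℕ
  u v : Fin n
  a b c : Fin σ
  p q r t α γ : List (Fin σ)
  i j w x x' y y' z : Str σ
  P : Str σ → Set

≈-refl : x ≈ x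
≈-refl {x = fin _} = refl
≈-refl {x = inf _} = λ _ → refl

≈-sym : x ≈ y → y ≈ x
≈-sym {x = fin _} {fin _} e = sym e
≈-sym {x = inf _} {inf _} e = λ k → sym (e k)
≈-sym {x = fin _} {inf _} ()
≈-sym {x = inf _} {fin _} ()

≈-trans : x ≈ y → y ≈ z → x ≈ z
≈-trans {x = fin _} {fin _} {fin _} e e' = trans e e'
≈-trans {x = inf _} {inf _} {inf _} e e' = λ k → trans (e k) (e' k)
≈-trans {x = fin _} {inf _} ()
≈-trans {x = inf _} {fin _} ()
≈-trans {x = fin _} {fin _} {inf _} _ ()
≈-trans {x = inf _} {inf _} {fin _} _ ()

snoc : Str σ → Fin σ → Str σ
snoc (fin r) a = fin (a ∷ r)
snoc (inf f) a = inf λ { zero → a ; (suc k) → f k }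

unsnoc-snoc : unsnoc (snoc x a) ≡ just (a , x)
unsnoc-snoc {x = fin _} = refl
unsnoc-snoc {x = inf _} = refl

snoc-cong : x ≈ y → snoc x a ≈ snoc y a
snoc-cong {x = fin _} {fin _} refl = refl
snoc-cong {x = inf _} {inf _} e = λ { zero → refl ; (suc k) → e k }
snoc-cong {x = fin _} {inf _} ()
snoc-cong {x = inf _} {fin _} ()

unsnoc≡just⇒≈snoc : unsnoc x ≡ just (a , x') → x ≈ snoc x' a
unsnoc≡just⇒≈snoc {x = fin (_ ∷ _)} refl = refl
unsnoc≡just⇒≈snoc {x = inf _} refl = λ { zero → refl ; (suc _) → refl }

unsnoc-functional :
  unsnoc x ≡ just (a , x') → unsnoc x ≡ just (b , y') → a ≡ b × x' ≡ y'
unsnoc-functional ux ux' = Product.,-injective (Maybe.just-injective (trans (sym ux) ux'))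

unsnoc-resp-≈ :
  x ≈ y → unsnoc x ≡ just (a , x') → ∃[ y' ] unsnoc y ≡ just (a , y') × x' ≈ y'
unsnoc-resp-≈ {x = fin (_ ∷ r)} {fin _} refl refl = fin r , refl , refl
unsnoc-resp-≈ {x = inf _} {inf g} e refl =
  inf (λ k → g (suc k)) , cong (λ c → just (c , _)) (sym (e 0)) , λ k → e (suc k)
unsnoc-resp-≈ {x = fin []} {fin _} _ ()
unsnoc-resp-≈ {x = fin _} {inf _} ()
unsnoc-resp-≈ {x = inf _} {fin _} ()

≈-unsnoc : unsnoc x ≡ just (a , x') → unsnoc y ≡ just (a , y') → x' ≈ y' → x ≈ y
≈-unsnoc ux uy x'≈y' =
  ≈-trans (unsnoc≡just⇒≈snoc ux)
          (≈-trans (snoc-cong x'≈y') (≈-sym (unsnoc≡just⇒≈snoc uy)))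

ε-≤ˢ : fin [] ≤ˢ x
ε-≤ˢ {x = fin []} = inj₂ refl
ε-≤ˢ {x = fin (_ ∷ _)} = inj₁ (ε< refl)
ε-≤ˢ {x = inf _} = inj₁ (ε< refl)

<ˢ-respʳ-≈ : x <ˢ y → y ≈ z → x <ˢ z
<ˢ-respʳ-≈ (ε< uy) y≈z with unsnoc-resp-≈ y≈z uy
... | _ , uz , _ = ε< uz
<ˢ-respʳ-≈ (hd< ux uy a<b) y≈z with unsnoc-resp-≈ y≈z uy
... | _ , uz , _ = hd< ux uz a<b
<ˢ-respʳ-≈ (tl< ux uy x'<y') y≈z with unsnoc-resp-≈ y≈z uy
... | _ , uz , y'≈z' = tl< ux uz (<ˢ-respʳ-≈ x'<y' y'≈z')

<ˢ-irrefl : x <ˢ y → ¬ x ≈ y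
<ˢ-irrefl {y = fin []} (ε< ()) _
<ˢ-irrefl {y = fin (_ ∷ _)} (ε< _) ()
<ˢ-irrefl {y = inf _} (ε< _) ()
<ˢ-irrefl (hd< ux uy a<b) x≈y with unsnoc-resp-≈ x≈y ux
... | _ , uy' , _ = F.<-irrefl (sym (proj₁ (unsnoc-functional uy uy'))) a<b
<ˢ-irrefl (tl< ux uy x'<y') x≈y with unsnoc-resp-≈ x≈y ux
... | _ , uy' , x'≈y'' with refl , refl ← unsnoc-functional uy uy' = <ˢ-irrefl x'<y' x'≈y''

<ˢ-trans : x <ˢ y → y <ˢ z → x <ˢ z
<ˢ-trans (ε< ()) (ε< _)
<ˢ-trans (ε< _) (hd< _ uz _) = ε< uz
<ˢ-trans (ε< _) (tl< _ uz _) = ε< uz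
<ˢ-trans (hd< _ () _) (ε< _)
<ˢ-trans (tl< _ () _) (ε< _)
<ˢ-trans (hd< ux uy a<b) (hd< uy' uz b<c)
  with refl , refl ← unsnoc-functional uy uy' = hd< ux uz (F.<-trans a<b b<c)
<ˢ-trans (hd< ux uy a<b) (tl< uy' uz _)
  with refl , refl ← unsnoc-functional uy uy' = hd< ux uz a<b
<ˢ-trans (tl< ux uy _) (hd< uy' uz a<c)
  with refl , refl ← unsnoc-functional uy uy' = hd< ux uz a<c
<ˢ-trans (tl< ux uy x'<y') (tl< uy' uz y'<z')
  with refl , refl ← unsnoc-functional uy uy' = tl< ux uz (<ˢ-trans x'<y' y'<z')

<ˢ-asym : x <ˢ y → ¬ y ≤ˢ x
<ˢ-asym x<y (inj₁ y<x) = <ˢ-irrefl (<ˢ-trans x<y y<x) ≈-refl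
<ˢ-asym x<y (inj₂ y≈x) = <ˢ-irrefl x<y (≈-sym y≈x)

≤ˢ-antisym : x ≤ˢ y → y ≤ˢ x → x ≈ y
≤ˢ-antisym (inj₂ x≈y) _ = x≈y
≤ˢ-antisym (inj₁ x<y) y≤x = ⊥-elim (<ˢ-asym x<y y≤x)

≤ˢ-respʳ-≈ : x ≤ˢ y → y ≈ z → x ≤ˢ z
≤ˢ-respʳ-≈ (inj₁ x<y) y≈z = inj₁ (<ˢ-respʳ-≈ x<y y≈z)
≤ˢ-respʳ-≈ (inj₂ x≈y) y≈z = inj₂ (≈-trans x≈y y≈z)

<ˢ-unsnoc : a F.≤ b → unsnoc x ≡ just (a , x') → unsnoc y ≡ just (b , y') →
            x' <ˢ y' → x <ˢ y
<ˢ-unsnoc a≤b ux uy x'<y' with ℕ.m≤n⇒m<n∨m≡n a≤b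
... | inj₁ a<b = hd< ux uy a<b
... | inj₂ a≡b with F.toℕ-injective a≡b
... | refl = tl< ux uy x'<y'

≤ˢ-unsnoc : a F.≤ b → unsnoc x ≡ just (a , x') → unsnoc y ≡ just (b , y') →
            x' ≤ˢ y' → x ≤ˢ y
≤ˢ-unsnoc a≤b ux uy (inj₁ x'<y') = inj₁ (<ˢ-unsnoc a≤b ux uy x'<y')
≤ˢ-unsnoc a≤b ux uy (inj₂ x'≈y') with ℕ.m≤n⇒m<n∨m≡n a≤b
... | inj₁ a<b = inj₁ (hd< ux uy a<b)
... | inj₂ a≡b with F.toℕ-injective a≡b
... | refl = inj₂ (≈-unsnoc ux uy x'≈y')

<ˢ⇒letter : {x y : Str σ} → x <ˢ y → Fin σ
<ˢ⇒letter (ε< {b = b} _) = b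
<ˢ⇒letter (hd< {b = b} _ _ _) = b
<ˢ⇒letter (tl< {a = a} _ _ _) = a

-- A letter only serves to show that the alphabet is nonempty.
leastLetter : Fin σ → Σ[ z ∈ Fin σ ] (∀ (b : Fin σ) → z F.≤ b)
leastLetter zero = zero , λ _ → ℕ.z≤n
leastLetter (suc _) = zero , λ _ → ℕ.z≤n

fin-<ˢ-++ : fin p <ˢ fin (p ++ [ c ])
fin-<ˢ-++ {p = []} = ε< refl
fin-<ˢ-++ {p = a ∷ p} = tl< refl refl fin-<ˢ-++

<ˢ⇒++least-≤ˢ : {c : Fin σ} → (∀ (b : Fin σ) → c F.≤ b) →
                fin p <ˢ y → fin (p ++ [ c ]) ≤ˢ y
<ˢ⇒++least-≤ˢ {p = []} least (ε< uy) = ≤ˢ-unsnoc (least _) refl uy ε-≤ˢ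
<ˢ⇒++least-≤ˢ {p = []} _ (hd< () _ _)
<ˢ⇒++least-≤ˢ {p = []} _ (tl< () _ _)
<ˢ⇒++least-≤ˢ {p = _ ∷ _} _ (hd< refl uy a<b) = inj₁ (hd< refl uy a<b)
<ˢ⇒++least-≤ˢ {p = _ ∷ _} least (tl< refl uy p<y') =
  ≤ˢ-unsnoc ℕ.≤-refl refl uy (<ˢ⇒++least-≤ˢ least p<y')

SuffixRev-resp-≈ : (r : List (Fin σ)) → SuffixRev r Respects _≈_
SuffixRev-resp-≈ [] _ _ = tt
SuffixRev-resp-≈ (a ∷ r) x≈y (x' , ux , r⊑x') with unsnoc-resp-≈ x≈y ux
... | y' , uy , x'≈y' = y' , uy , SuffixRev-resp-≈ r x'≈y' r⊑x'

SuffixRev-refl : SuffixRev r (fin r)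
SuffixRev-refl {r = []} = tt
SuffixRev-refl {r = a ∷ r} = fin r , refl , SuffixRev-refl

SuffixRev⇒≤ˢ : SuffixRev r y → fin r ≤ˢ y
SuffixRev⇒≤ˢ {r = []} _ = ε-≤ˢ
SuffixRev⇒≤ˢ {r = a ∷ r} (_ , uy , r⊑y') =
  ≤ˢ-unsnoc ℕ.≤-refl refl uy (SuffixRev⇒≤ˢ r⊑y')

SuffixRev-fin⇒++ : SuffixRev r (fin q) → ∃[ q' ] q ≡ r ++ q'
SuffixRev-fin⇒++ {r = []} {q = q} _ = q , refl
SuffixRev-fin⇒++ {r = a ∷ r} {q = _ ∷ q} (_ , refl , r⊑q) with SuffixRev-fin⇒++ r⊑q
... | q' , q≡r++q' = q' , cong (a ∷_) q≡r++q'
SuffixRev-fin⇒++ {r = _ ∷ _} {q = []} (_ , () , _)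

IsSuffix-⟦⟧ : IsSuffix α ⟦ γ ⟧ → ∃[ β ] γ ≡ β ++ α
IsSuffix-⟦⟧ {α = α} {γ = γ} α⊑γ with SuffixRev-fin⇒++ α⊑γ
... | q , γᴿ≡αᴿ++q = reverse q , List.reverse-injective (begin
  reverse γ                        ≡⟨ γᴿ≡αᴿ++q ⟩
  reverse α ++ q                   ≡⟨ cong (reverse α ++_) (List.reverse-involutive q) ⟨
  reverse α ++ reverse (reverse q) ≡⟨ List.reverse-++ (reverse q) α ⟨
  reverse (reverse q ++ α)         ∎)
  where open ≡-Reasoning

nextLetter : Fin σ → Maybe (Fin σ)
nextLetter {σ = σ} a with suc (toℕ a) ℕ.<? σ
... | yes a+1<σ = just (F.fromℕ< a+1<σ)
... | no _ = nothing

nextLetter-just : {a b : Fin σ} → nextLetter a ≡ just b → toℕ b ≡ suc (toℕ a)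
nextLetter-just {σ = σ} {a = a} eq with suc (toℕ a) ℕ.<? σ
nextLetter-just refl | yes a+1<σ = F.toℕ-fromℕ< a+1<σ
nextLetter-just () | no _

nextLetter-nothing : {a c : Fin σ} → nextLetter a ≡ nothing → ¬ a F.< c
nextLetter-nothing {σ = σ} {a = a} {c = c} eq a<c with suc (toℕ a) ℕ.<? σ
nextLetter-nothing () _ | yes _
... | no a+1≮σ = a+1≮σ (ℕ.≤-<-trans a<c (F.toℕ<n c))

nextLetter-increasing : nextLetter a ≡ just b → a F.< b
nextLetter-increasing eq = ℕ.≤-reflexive (sym (nextLetter-just eq))

nextLetter-least : nextLetter a ≡ just b → a F.< c → b F.≤ c
nextLetter-least eq a<c = ℕ.≤-trans (ℕ.≤-reflexive (nextLetter-just eq)) a<c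

-- Strings are stored reversed, so r lists a suffix from its last letter on.
-- blockSucc r is the least string above all strings with suffix r: the leftmost
-- letter of r that can be increased is increased and everything left of it dropped.
blockSucc : List (Fin σ) → Maybe (List (Fin σ))
blockSucc [] = nothing
blockSucc (a ∷ r) =
  maybe′ (λ t → just (a ∷ t)) (Maybe.map [_] (nextLetter a)) (blockSucc r)

<ˢ-blockSucc : SuffixRev r w → blockSucc r ≡ just t → w <ˢ fin t
<ˢ-blockSucc {r = []} _ ()
<ˢ-blockSucc {r = a ∷ r} (_ , uw , r⊑w') eq with blockSucc r in eq'
<ˢ-blockSucc {r = a ∷ r} (_ , uw , r⊑w') refl | just _ = tl< uw refl (<ˢ-blockSucc r⊑w' eq')
... | nothing with nextLetter a in next
<ˢ-blockSucc (_ , uw , _) refl | nothing | just _ = hd< uw refl (nextLetter-increasing next)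
<ˢ-blockSucc _ () | nothing | nothing

blockSucc-≤ˢ : SuffixRev r w → ¬ SuffixRev r y → w ≤ˢ y →
               ∃[ t ] blockSucc r ≡ just t × fin t ≤ˢ y
blockSucc-≤ˢ {r = []} _ r⋢y _ = ⊥-elim (r⋢y tt)
blockSucc-≤ˢ {r = r} r⊑w r⋢y (inj₂ w≈y) =
  ⊥-elim (r⋢y (SuffixRev-resp-≈ r w≈y r⊑w))
blockSucc-≤ˢ {r = _ ∷ _} (_ , () , _) _ (inj₁ (ε< _))
blockSucc-≤ˢ {r = a ∷ r} (_ , uw , _) _ (inj₁ (hd< uw' uy a<b))
  with refl , refl ← unsnoc-functional uw uw' | blockSucc r
... | just t = a ∷ t , refl , inj₁ (hd< refl uy a<b)
... | nothing with nextLetter a in next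
... | just c = [ c ] , refl , ≤ˢ-unsnoc (nextLetter-least next a<b) refl uy ε-≤ˢ
... | nothing = ⊥-elim (nextLetter-nothing next a<b)
blockSucc-≤ˢ {r = a ∷ r} (_ , uw , r⊑w') r⋢y (inj₁ (tl< uw' uy w'<y'))
  with refl , refl ← unsnoc-functional uw uw'
  with t , eq , t≤y' ← blockSucc-≤ˢ r⊑w' (λ r⊑y' → r⋢y (_ , uy , r⊑y')) (inj₁ w'<y')
  = a ∷ t , cong (maybe′ _ _) eq , ≤ˢ-unsnoc ℕ.≤-refl refl uy t≤y'

maxString : ∀ {m} → Str (suc m)
maxString {m} = inf λ _ → fromℕ m

fin<ˢmaxString : ∀ {m} (q : List (Fin (suc m))) → fin q <ˢ maxString
fin<ˢmaxString [] = ε< refl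
fin<ˢmaxString (a ∷ q) = <ˢ-unsnoc (F.≤fromℕ a) refl refl (fin<ˢmaxString q)

-- The greatest string below every string whose last letter is a: empty for the
-- least letter, and (max)^ω followed by the predecessor of a otherwise.
lastBelow : Fin σ → Str σ
lastBelow zero = fin []
lastBelow (suc c) = snoc maxString (inject₁ c)

lastBelow-<ˢ : unsnoc w ≡ just (a , y) → lastBelow a <ˢ w
lastBelow-<ˢ {a = zero} uw = ε< uw
lastBelow-<ˢ {a = suc c} uw = hd< refl uw (ℕ.≤-reflexive (cong suc (F.toℕ-inject₁ c)))

≤ˢ-lastBelow : b F.< a → fin (b ∷ q) ≤ˢ lastBelow a
≤ˢ-lastBelow {b = b} {a = suc c} {q = q} b<a =
  inj₁ (<ˢ-unsnoc b≤c refl refl (fin<ˢmaxString q))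
  where
  b≤c : b F.≤ inject₁ c
  b≤c = subst (toℕ b ℕ.≤_) (sym (F.toℕ-inject₁ c)) (ℕ.s≤s⁻¹ b<a)

blockPred : Fin σ → List (Fin σ) → Str σ
blockPred a [] = lastBelow a
blockPred a (b ∷ r) = snoc (blockPred b r) a

blockPred-<ˢ : SuffixRev (a ∷ r) w → blockPred a r <ˢ w
blockPred-<ˢ {r = []} (_ , uw , _) = lastBelow-<ˢ uw
blockPred-<ˢ {r = _ ∷ _} (_ , uw , r⊑w') = tl< unsnoc-snoc uw (blockPred-<ˢ r⊑w')

≤ˢ-blockPred : SuffixRev (a ∷ r) w → ¬ SuffixRev (a ∷ r) (fin q) → fin q ≤ˢ w →
               fin q ≤ˢ blockPred a r
≤ˢ-blockPred {q = []} _ _ _ = ε-≤ˢ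
≤ˢ-blockPred {a = a} {r = r} {q = _ ∷ _} ar⊑w ar⋢q (inj₂ q≈w) =
  ⊥-elim (ar⋢q (SuffixRev-resp-≈ (a ∷ r) (≈-sym q≈w) ar⊑w))
≤ˢ-blockPred {r = []} {q = _ ∷ _} (_ , uw , _) _ (inj₁ (hd< refl uw' b<a))
  with refl , refl ← unsnoc-functional uw uw' = ≤ˢ-lastBelow b<a
≤ˢ-blockPred {r = _ ∷ _} {q = _ ∷ _} (_ , uw , _) _ (inj₁ (hd< refl uw' b<a))
  with refl , refl ← unsnoc-functional uw uw' = inj₁ (hd< refl unsnoc-snoc b<a)
≤ˢ-blockPred {r = []} {q = _ ∷ _} (_ , uw , _) ar⋢q (inj₁ (tl< refl uw' _))
  with refl , refl ← unsnoc-functional uw uw' = ⊥-elim (ar⋢q (_ , refl , tt))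
≤ˢ-blockPred {r = _ ∷ _} {q = _ ∷ _} (_ , uw , r⊑w') ar⋢q (inj₁ (tl< refl uw' q'<w'))
  with refl , refl ← unsnoc-functional uw uw' =
  ≤ˢ-unsnoc ℕ.≤-refl refl unsnoc-snoc
    (≤ˢ-blockPred r⊑w' (λ r⊑q' → ar⋢q (_ , refl , r⊑q')) (inj₁ q'<w'))

inf≈member : IsInf i P → P x → (∀ y → P y → y ≈ x) → i ≈ x
inf≈member (lb , glb) Px all =
  ≤ˢ-antisym (lb _ Px) (glb _ λ y Py → inj₂ (≈-sym (all y Py)))

sup≈member : IsSup j P → P x → (∀ y → P y → y ≈ x) → j ≈ x
sup≈member (ub , lub) Px all = ≤ˢ-antisym (lub _ λ y Py → inj₂ (all y Py)) (ub _ Px)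

singleton⇒≈inf : IsInf i P → IsSingleton P → P y → y ≈ i
singleton⇒≈inf isInf (x , Px , all) Py =
  ≈-trans (all _ Py) (≈-sym (inf≈member isInf Px all))

singleton⇒inf≈sup : IsInf i P → IsSup j P → IsSingleton P → i ≈ j
singleton⇒inf≈sup isInf isSup (x , Px , all) =
  ≈-trans (inf≈member isInf Px all) (≈-sym (sup≈member isSup Px all))

inf≈sup⇒≈inf : IsInf i P → IsSup j P → i ≈ j → P y → y ≈ i
inf≈sup⇒≈inf (lb , _) (ub , _) i≈j Py =
  ≤ˢ-antisym (≤ˢ-respʳ-≈ (ub _ Py) (≈-sym i≈j)) (lb _ Py)

inf≈sup⇒singleton : IsInf i P → IsSup j P → Satisfiable P → i ≈ j → IsSingleton P
inf≈sup⇒singleton {i = i} {P = P} isInf isSup (y₀ , Py₀) i≈j =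
  y₀ , Py₀ , λ y Py → ≈-trans (≈inf Py) (≈-sym (≈inf Py₀))
  where
  ≈inf : ∀ {y} → P y → y ≈ i
  ≈inf = inf≈sup⇒≈inf isInf isSup i≈j

suffixOfInf-¬¬shared :
  IsInf i P → Satisfiable P → SuffixRev r i → ¬ ¬ (∃[ y ] P y × SuffixRev r y)
suffixOfInf-¬¬shared {P = P} {r = r} (lb , glb) (y₀ , Py₀) r⊑i none =
  <ˢ-asym (<ˢ-blockSucc r⊑i succ-def) (glb (fin succ) lower)
  where
  above : ∀ {y} → P y → ∃[ t ] blockSucc r ≡ just t × fin t ≤ˢ y
  above Py = blockSucc-≤ˢ r⊑i (λ r⊑y → none (_ , Py , r⊑y)) (lb _ Py)
  succ : List _
  succ = proj₁ (above Py₀)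
  succ-def : blockSucc r ≡ just succ
  succ-def = proj₁ (proj₂ (above Py₀))
  lower : ∀ y → P y → fin succ ≤ˢ y
  lower y Py with above Py
  ... | t , t-def , t≤y =
    subst (λ t → fin t ≤ˢ y) (Maybe.just-injective (trans (sym t-def) succ-def)) t≤y

suffixOfSup-¬¬shared : IsSup j P → Satisfiable P → P ⊆ IsFinite →
                       SuffixRev r j → ¬ ¬ (∃[ y ] P y × SuffixRev r y)
suffixOfSup-¬¬shared {r = []} _ (y₀ , Py₀) _ _ none = none (y₀ , Py₀ , tt)
suffixOfSup-¬¬shared {P = P} {r = a ∷ r} (ub , lub) _ finite ar⊑j none =
  <ˢ-asym (blockPred-<ˢ ar⊑j) (lub _ upper)
  where
  upper : ∀ y → P y → y ≤ˢ blockPred a r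
  upper (fin q) Py = ≤ˢ-blockPred ar⊑j (λ ar⊑q → none (_ , Py , ar⊑q)) (ub _ Py)
  upper (inf _) Py = ⊥-elim (finite Py)

finiteInf-¬¬member : IsInf (fin p) P → Satisfiable P → P Respects _≈_ → ¬ ¬ P (fin p)
finiteInf-¬¬member {p = p} {P = P} (lb , glb) (y₀ , Py₀) resp ¬Pp =
  <ˢ-asym fin-<ˢ-++ (glb _ λ y Py → <ˢ⇒++least-≤ˢ (proj₂ least) (above Py))
  where
  above : ∀ {y} → P y → fin p <ˢ y
  above {y} Py with lb y Py
  ... | inj₁ p<y = p<y
  ... | inj₂ p≈y = ⊥-elim (¬Pp (resp (≈-sym p≈y) Py))
  least : Σ[ z ∈ Fin _ ] (∀ b → z F.≤ b)
  least = leastLetter (<ˢ⇒letter (above Py₀))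

finiteSup-¬¬member :
  IsSup (fin p) P → Satisfiable P → P ⊆ IsFinite → P Respects _≈_ → ¬ ¬ P (fin p)
finiteSup-¬¬member isSup inhabited finite resp ¬Pp =
  suffixOfSup-¬¬shared isSup inhabited finite SuffixRev-refl λ (y , Py , p⊑y) →
    ¬Pp (resp (≤ˢ-antisym (proj₁ isSup y Py) (SuffixRev⇒≤ˢ p⊑y)) Py)

IsExtremum : Str σ → (Str σ → Set) → Set
IsExtremum x P = IsInf x P ⊎ IsSup x P

finiteExtremum-¬¬member : IsExtremum (fin p) P → Satisfiable P → P ⊆ IsFinite →
                          P Respects _≈_ → ¬ ¬ P (fin p)
finiteExtremum-¬¬member (inj₁ isInf) inhabited _ resp = finiteInf-¬¬member isInf inhabited resp
finiteExtremum-¬¬member (inj₂ isSup) inhabited finite resp =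
  finiteSup-¬¬member isSup inhabited finite resp

δ*-++ : (A : DFA n σ) (q : Fin n) (β α : List (Fin σ)) →
        δ* A q (β ++ α) ≡ (δ* A q β >>= λ p → δ* A p α)
δ*-++ A q [] α = refl
δ*-++ A q (b ∷ β) α with δ A q b
... | nothing = refl
... | just q' = δ*-++ A q' β α

I-resp-≈ : (A : DFA n σ) → I A u Respects _≈_
I-resp-≈ A x≈y (γ , x≈γ , run) = γ , ≈-trans (≈-sym x≈y) x≈γ , run

I-finite : (A : DFA n σ) → I A u ⊆ IsFinite
I-finite A {fin _} _ = tt
I-finite A {inf _} (_ , () , _)

I-fin? : (A : DFA n σ) (u : Fin n) (p : List (Fin σ)) → Dec (I A u (fin p))
I-fin? A u p = map′ (λ run → reverse p , sym (List.reverse-involutive p) , run) accepted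
  (Maybe.≡-dec F._≟_ (δ* A (s A) (reverse p)) (just u))
  where
  accepted : I A u (fin p) → δ* A (s A) (reverse p) ≡ just u
  accepted (γ , refl , run) =
    subst (λ γ′ → δ* A (s A) γ′ ≡ just u) (sym (List.reverse-involutive γ)) run

I-disjoint : (A : DFA n σ) → v ≢ u → I A u x → I A v x → ⊥
I-disjoint A v≢u (γ , x≈γ , run) (γ' , x≈γ' , run')
  with refl ← List.reverse-injective {x = γ} {y = γ'} (≈-trans (≈-sym x≈γ) x≈γ') =
  v≢u (Maybe.just-injective (trans (sym run') run))

I-suffix⇒run : (A : DFA n σ) → I A u y → IsSuffix α y → ∃[ q ] δ* A q α ≡ just u
I-suffix⇒run {α = α} A (γ , y≈γ , run) α⊑y
  with β , refl ← IsSuffix-⟦⟧ {α = α} {γ = γ} (SuffixRev-resp-≈ (reverse α) y≈γ α⊑y)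
  with δ* A (s A) β | δ*-++ A (s A) β α
... | just q | split = q , trans (sym split) run
... | nothing | split with () ← trans (sym split) run

I-satisfiable : (A : DFA n σ) → Standing A → Satisfiable (I A u)
I-satisfiable {u = u} A st with Standing.reachable st u
... | γ , run = ⟦ γ ⟧ , γ , ≈-refl , run

¬¬suffix⇒extension : (A : DFA n σ) → Standing A →
  ¬ ¬ (∃[ y ] I A u y × IsSuffix α y) → ∃[ β ] I A u ⟦ β ++ α ⟧
¬¬suffix⇒extension {u = u} {α = α} A st ¬¬suffix
  with F.any? (λ q → Maybe.≡-dec F._≟_ (δ* A q α) (just u))
... | no ¬run = ⊥-elim (¬¬suffix λ (_ , y∈ , α⊑y) → ¬run (I-suffix⇒run {α = α} A y∈ α⊑y))
... | yes (q , run) with β , reach ← Standing.reachable st q =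
  β , β ++ α , ≈-refl , (begin
    δ* A (s A) (β ++ α)               ≡⟨ δ*-++ A (s A) β α ⟩
    (δ* A (s A) β >>= λ p → δ* A p α) ≡⟨ cong (_>>= λ p → δ* A p α) reach ⟩
    δ* A q α                          ≡⟨ run ⟩
    just u                            ∎)
  where open ≡-Reasoning

finiteExtremum-member : (A : DFA n σ) → Standing A → IsExtremum x (I A u) → IsFinite x → I A u x
finiteExtremum-member {x = fin p} {u = u} A st extremum _ =
  decidable-stable (I-fin? A u p)
    (finiteExtremum-¬¬member extremum (I-satisfiable A st) (I-finite A) (I-resp-≈ A))

sharedExtremum-infinite : (A : DFA n σ) → Standing A → v ≢ u →
  IsExtremum x (I A u) → IsExtremum y (I A v) → x ≈ y → IsInfinite x
sharedExtremum-infinite {x = inf _} _ _ _ _ _ _ = tt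
sharedExtremum-infinite {x = fin _} {y = inf _} _ _ _ _ _ ()
sharedExtremum-infinite {x = fin _} {y = fin _} A st v≢u x-extremum y-extremum refl =
  I-disjoint A v≢u (finiteExtremum-member A st x-extremum tt)
                   (finiteExtremum-member A st y-extremum tt)

mainTheorem1 : ∀ {n σ} (A : DFA n σ) → Standing A → (u : Fin n) →
    (iu su : Str σ) → IsInf iu (I A u) → IsSup su (I A u) →
    (∀ x → I A u x → IsFinite x)
    × (∀ v → v ≢ u → ∀ x → I A u x → I A v x → ⊥)
    × (∀ α → IsSuffix α iu → ∃ λ β → I A u ⟦ β ++ α ⟧)
    × (∀ α → IsSuffix α su → ∃ λ β → I A u ⟦ β ++ α ⟧)
    × (I A u iu ⇔ IsFinite iu)
    × (I A u su ⇔ IsFinite su)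
    × (IsSingleton (I A u) ⇔ iu ≈ su)
    × (IsSingleton (I A u) →
        (∀ x → I A u x ⇔ x ≈ iu) × I A u iu × iu ≈ su × I A u su × IsFinite iu)
    × (∀ v → v ≢ u → (iv sv : Str σ) → IsInf iv (I A v) → IsSup sv (I A v) →
        ((iu ≈ iv ⊎ iu ≈ sv) → IsInfinite iu)
        × ((su ≈ iv ⊎ su ≈ sv) → IsInfinite su))
mainTheorem1 A st u iu su hi hs =
    (λ _ → I-finite A)
  , (λ _ v≢u _ → I-disjoint A v≢u)
  , (λ _ α⊑iu → ¬¬suffix⇒extension A st (suffixOfInf-¬¬shared hi inhabited α⊑iu))
  , (λ _ α⊑su →
      ¬¬suffix⇒extension A st (suffixOfSup-¬¬shared hs inhabited (I-finite A) α⊑su))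
  , mk⇔ (I-finite A) (finiteExtremum-member A st (inj₁ hi))
  , mk⇔ (I-finite A) (finiteExtremum-member A st (inj₂ hs))
  , mk⇔ (singleton⇒inf≈sup hi hs) (inf≈sup⇒singleton hi hs inhabited)
  , singleton-facts
  , λ _ v≢u _ _ hiv hsv →
      [ sharedExtremum-infinite A st v≢u (inj₁ hi) (inj₁ hiv)
      , sharedExtremum-infinite A st v≢u (inj₁ hi) (inj₂ hsv) ]′
    , [ sharedExtremum-infinite A st v≢u (inj₂ hs) (inj₁ hiv)
      , sharedExtremum-infinite A st v≢u (inj₂ hs) (inj₂ hsv) ]′
  where
  inhabited : Satisfiable (I A u)
  inhabited = I-satisfiable A st

  singleton-facts : IsSingleton (I A u) →
    (∀ x → I A u x ⇔ x ≈ iu) × I A u iu × iu ≈ su × I A u su × IsFinite iu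
  singleton-facts single@(_ , x₀∈ , _) =
    (λ _ → mk⇔ (singleton⇒≈inf hi single) (λ x≈iu → I-resp-≈ A (≈-sym x≈iu) iu∈))
    , iu∈ , iu≈su , I-resp-≈ A iu≈su iu∈ , I-finite A iu∈
    where
    iu∈ : I A u iu
    iu∈ = I-resp-≈ A (singleton⇒≈inf hi single x₀∈) x₀∈
    iu≈su : iu ≈ su
    iu≈su = singleton⇒inf≈sup hi hs single
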